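{- Let $d\geq 2$ and $\mathbf{k}=(k_1,\dots,k_{d+1})$ positive integers. The set $F_{\mathbf{k}}=\{a_1w_1+\dots+a_{d+1}w_{d+1}: a_i\in\mathbb{Z},\ 0\le a_i\le k_i,\ \text{at least one } a_i=0\}$ is a system of representatives of the classes of $\Lambda_d/L_{\mathbf{k}}$.
   Context: Let $e_1,\dots,e_{d+1}$ be the standard basis of $\mathbb{R}^{d+1}$, $w_i=(d+1)e_i-\sum_je_j$, $\Lambda_d=\{\sum a_iw_i: a_i\in\mathbb{Z}\}$. $M_{\mathbf{k}}$ is the $(d+1)\times(d+1)$ integer matrix whose $i$-th row has entry $k_i+1$ in column $i$, entry $-k_{i+1}$ in column $i+1$ (indices cyclic mod $d+1$), zeros elsewhere. $L_{\mathbf{k}}=\{\sum a_iw_i: (a_1,\dots,a_{d+1})=(b_1,\dots,b_{d+1})M_{\mathbf{k}},\ b\in\mathbb{Z}^{d+1}\}$. -}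

module Defs where

open import Data.Nat as ℕ using (ℕ; zero; suc)
open import Data.Nat.DivMod using (_mod_)
open import Data.Integer using (ℤ; +_; _+_; _*_; -_; _-_)
open import Data.Fin using (Fin; toℕ)
import Data.Fin as Fin
open import Data.Bool using (if_then_else_)
open import Relation.Nullary.Decidable using (⌊_⌋)
open import Data.Product using (Σ; ∃; _×_)
open import Relation.Binary.PropositionalEquality using (_≡_)

-- Points of ℤ^n (we work in ℤ^{d+1} ⊂ ℝ^{d+1}; all points involved are integral)
Pt : ℕ → Set
Pt n = Fin n → ℤ

Σᶠ : ∀ {n} → (Fin n → ℤ) → ℤ
Σᶠ {zero}  f = + 0
Σᶠ {suc n} f = f Fin.zero + Σᶠ (λ i → f (Fin.suc i))

δ : ∀ {n} → Fin n → Fin n → ℤ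
δ i j = if ⌊ i Fin.≟ j ⌋ then + 1 else + 0

w : (d : ℕ) → Fin (suc d) → Pt (suc d)
w d i j = (+ (suc d)) * δ i j - + 1

comb : (d : ℕ) → (Fin (suc d) → ℤ) → Pt (suc d)
comb d a j = Σᶠ (λ i → a i * w d i j)

nxt : (d : ℕ) → Fin (suc d) → Fin (suc d)
nxt d i = suc (toℕ i) mod (suc d)

M : (d : ℕ) → (Fin (suc d) → ℕ) → Fin (suc d) → Fin (suc d) → ℤ
M d k i j = (+ (suc (k i))) * δ i j + (- (+ k (nxt d i))) * δ (nxt d i) j

vecMat : (d : ℕ) → (Fin (suc d) → ℤ) → (Fin (suc d) → Fin (suc d) → ℤ) → Fin (suc d) → ℤ
vecMat d b A j = Σᶠ (λ i → b i * A i j)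

InΛ : (d : ℕ) → Pt (suc d) → Set
InΛ d x = Σ (Fin (suc d) → ℤ) λ a → ∀ j → x j ≡ comb d a j

InL : (d : ℕ) → (Fin (suc d) → ℕ) → Pt (suc d) → Set
InL d k x = Σ (Fin (suc d) → ℤ) λ b → ∀ j → x j ≡ comb d (vecMat d b (M d k)) j

InF : (d : ℕ) → (Fin (suc d) → ℕ) → Pt (suc d) → Set
InF d k x = Σ (Fin (suc d) → ℕ) λ a →
  (∀ i → a i ℕ.≤ k i) × (∃ λ i → a i ≡ 0) × (∀ j → x j ≡ comb d (λ i → + (a i)) j)

_⊖_ : ∀ {n} → Pt n → Pt n → Pt n
(x ⊖ y) j = x j - y j

IsSystemOfReps : (d : ℕ) → (Fin (suc d) → ℕ) → Set
IsSystemOfReps d k =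
  (∀ x → InΛ d x → Σ (Pt (suc d)) λ y → InF d k y × InL d k (x ⊖ y))
  × (∀ y y' → InF d k y → InF d k y' → InL d k (y ⊖ y') → ∀ j → y j ≡ y' j)

-- Writing x = Σ aᵢ wᵢ, the coefficient vector a is determined by x up to adding a constant vector, and
-- since the rows of M_k sum to (1, …, 1), two coefficient vectors give points congruent modulo L_k exactly
-- when they differ by b M_k, whose j-th entry is b_j (k_j + 1) - b_{j-1} k_j. This is chip firing on a
-- cycle: site j fires by giving up k_j + 1 chips, of which k_{j+1} arrive at site j + 1.
--
-- Existence: shift all entries into ℕ, then carry each site i < d modulo k_i + 1 into the next one. While
-- the last site exceeds its bound, fire it once and carry again; now every carry is at most 1, so the
-- last entry strictly decreases. Finally subtract the minimal entry.
--
-- Uniqueness: let f - f′ = b M_k with f, f′ in the box. As f_j - f′_j ≤ k_j, b_j ≥ 1 forces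
-- b_{j-1} ≥ b_j, so a positive entry of b propagates backwards around the cycle and makes b constant;
-- then f - f′ is a positive constant, impossible at a zero of f. Hence b ≤ 0, symmetrically b ≥ 0,
-- and f = f′.

module Submission where

open import Data.Nat as ℕ using (ℕ; zero; suc; z≤n; s≤s; _≤_; _<_; _∸_)
import Data.Nat.Properties as ℕP
open import Data.Nat.DivMod using (_mod_; _%_; _/_; m<n⇒m%n≡m; n%n≡0; m%n<n; m%n≡m∸m/n*n; m/n*n≤m; m<n*o⇒m/o<n)
open import Data.Integer as ℤ using (ℤ; +_; _+_; _*_; -_; _-_; +≤+) renaming (_≤_ to _≤ℤ_)
import Data.Integer.Properties as ℤP
open import Data.Integer.Tactic.RingSolver using (solve-∀)
open import Data.Fin as Fin using (Fin; toℕ; fromℕ; inject₁; lower₁) renaming (zero to fzero; suc to fsuc)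
import Data.Fin.Properties as FinP
open import Data.Fin.Induction using (>-weakInduction)
open import Data.Empty using (⊥-elim)
open import Data.Sum using (_⊎_; inj₁; inj₂)
open import Data.Product using (Σ; ∃; _×_; _,_)
open import Function using (_∘_)
open import Relation.Nullary using (yes; no)
open import Relation.Binary.PropositionalEquality
open ≡-Reasoning
open import Defs

module Cyclic (d : ℕ) where

  pos : ℕ → Fin (suc d)
  pos m = m mod suc d

  toℕ-pos : ∀ {m} → m < suc d → toℕ (pos m) ≡ m
  toℕ-pos {m} m<1+d = trans (FinP.toℕ-fromℕ< (m%n<n m (suc d))) (m<n⇒m%n≡m m<1+d)

  pos-toℕ : ∀ i → pos (toℕ i) ≡ i
  pos-toℕ i = FinP.toℕ-injective (toℕ-pos (FinP.toℕ<n i))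

  below-or-last : ∀ i → toℕ i < d ⊎ i ≡ fromℕ d
  below-or-last i with ℕP.m≤n⇒m<n∨m≡n (FinP.toℕ≤pred[n] i)
  ... | inj₁ i<d = inj₁ i<d
  ... | inj₂ i≡d = inj₂ (FinP.toℕ-injective (trans i≡d (sym (FinP.toℕ-fromℕ d))))

  toℕ-nxt : ∀ {i} → toℕ i < d → toℕ (nxt d i) ≡ suc (toℕ i)
  toℕ-nxt i<d = toℕ-pos (s≤s i<d)

  nxt-last : nxt d (fromℕ d) ≡ fzero
  nxt-last = FinP.toℕ-injective (begin
    toℕ (pos (suc (toℕ (fromℕ d))))  ≡⟨ FinP.toℕ-fromℕ< (m%n<n (suc (toℕ (fromℕ d))) (suc d)) ⟩
    suc (toℕ (fromℕ d)) % suc d      ≡⟨ cong (λ m → suc m % suc d) (FinP.toℕ-fromℕ d) ⟩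
    suc d % suc d                    ≡⟨ n%n≡0 (suc d) ⟩
    0                                ∎)

  prev : Fin (suc d) → Fin (suc d)
  prev fzero    = fromℕ d
  prev (fsuc j) = inject₁ j

  nxt-prev : ∀ j → nxt d (prev j) ≡ j
  nxt-prev fzero    = nxt-last
  nxt-prev (fsuc j) = FinP.toℕ-injective (begin
    toℕ (nxt d (inject₁ j))  ≡⟨ toℕ-nxt (FinP.inject₁ℕ< j) ⟩
    suc (toℕ (inject₁ j))    ≡⟨ cong suc (FinP.toℕ-inject₁ j) ⟩
    suc (toℕ j)              ∎)

  prev-nxt : ∀ i → prev (nxt d i) ≡ i
  prev-nxt i with d ℕ.≟ toℕ i
  ... | yes d≡i = trans (cong prev (subst (λ j → nxt d j ≡ fzero) last≡i nxt-last)) last≡i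
    where last≡i = FinP.toℕ-injective (trans (FinP.toℕ-fromℕ d) d≡i)
  ... | no d≢i = begin
    prev (nxt d i)            ≡⟨ cong (prev ∘ nxt d) (sym i≡j) ⟩
    prev (nxt d (inject₁ j))  ≡⟨ cong prev (nxt-prev (fsuc j)) ⟩
    inject₁ j                 ≡⟨ i≡j ⟩
    i                         ∎
    where
    j = lower₁ i d≢i
    i≡j = FinP.inject₁-lower₁ i d≢i

  -- Going down from j₀ reaches 0, then prev 0 is the last index, and going down from there reaches everything.
  prev-induction : (P : Fin (suc d) → Set) → (∀ j → P j → P (prev j)) → ∀ {j₀} → P j₀ → ∀ i → P i
  prev-induction P step {j₀} Pj₀ = >-weakInduction P (step fzero (below-j₀ fzero z≤n)) (step ∘ fsuc)
    where
    below-j₀ : ∀ i → i Fin.≤ j₀ → P i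
    below-j₀ = >-weakInduction (λ i → i Fin.≤ j₀ → P i) from-last down
      where
      from-last : fromℕ d Fin.≤ j₀ → P (fromℕ d)
      from-last last≤j₀ = subst P (FinP.≤-antisym (FinP.≤fromℕ j₀) last≤j₀) Pj₀
      down : ∀ i → (fsuc i Fin.≤ j₀ → P (fsuc i)) → inject₁ i Fin.≤ j₀ → P (inject₁ i)
      down i ih i≤j₀ with ℕP.m≤n⇒m<n∨m≡n i≤j₀
      ... | inj₁ i<j₀ = step (fsuc i) (ih (subst (λ m → suc m ≤ toℕ j₀) (FinP.toℕ-inject₁ i) i<j₀))
      ... | inj₂ i≡j₀ = subst P (sym (FinP.toℕ-injective i≡j₀)) Pj₀

δ-refl : ∀ {n} (i : Fin n) → δ i i ≡ + 1
δ-refl i with i Fin.≟ i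
... | yes _  = refl
... | no i≢i = ⊥-elim (i≢i refl)

δ-≢ : ∀ {n} {i j : Fin n} → i ≢ j → δ i j ≡ + 0
δ-≢ {i = i} {j} i≢j with i Fin.≟ j
... | yes i≡j = ⊥-elim (i≢j i≡j)
... | no _    = refl

Σᶠ-cong : ∀ {n} {f g : Fin n → ℤ} → (∀ i → f i ≡ g i) → Σᶠ f ≡ Σᶠ g
Σᶠ-cong {zero}  f≗g = refl
Σᶠ-cong {suc n} f≗g = cong₂ _+_ (f≗g fzero) (Σᶠ-cong (f≗g ∘ fsuc))

Σᶠ-zero : ∀ {n} {f : Fin n → ℤ} → (∀ i → f i ≡ + 0) → Σᶠ f ≡ + 0
Σᶠ-zero {zero}  f≗0 = refl
Σᶠ-zero {suc n} f≗0 = cong₂ _+_ (f≗0 fzero) (Σᶠ-zero (f≗0 ∘ fsuc))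

Σᶠ-single : ∀ {n} (f : Fin n → ℤ) j → (∀ i → i ≢ j → f i ≡ + 0) → Σᶠ f ≡ f j
Σᶠ-single {suc n} f fzero    f≗0 =
  trans (cong (_+_ (f fzero)) (Σᶠ-zero (λ i → f≗0 (fsuc i) λ ())) ) (ℤP.+-identityʳ _)
Σᶠ-single {suc n} f (fsuc j) f≗0 =
  trans (cong₂ _+_ (f≗0 fzero λ ())
                   (Σᶠ-single (f ∘ fsuc) j (λ i i≢j → f≗0 (fsuc i) (i≢j ∘ FinP.suc-injective))))
        (ℤP.+-identityˡ _)

Σᶠ-+ : ∀ {n} (f g : Fin n → ℤ) → Σᶠ (λ i → f i + g i) ≡ Σᶠ f + Σᶠ g
Σᶠ-+ {zero}  f g = refl
Σᶠ-+ {suc n} f g = trans (cong (_+_ (f fzero + g fzero)) (Σᶠ-+ (f ∘ fsuc) (g ∘ fsuc)))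
  (interchange (f fzero) (g fzero) (Σᶠ (f ∘ fsuc)) (Σᶠ (g ∘ fsuc)))
  where
  interchange : ∀ a b c e → a + b + (c + e) ≡ a + c + (b + e)
  interchange = solve-∀

Σᶠ-neg : ∀ {n} (f : Fin n → ℤ) → Σᶠ (λ i → - f i) ≡ - Σᶠ f
Σᶠ-neg {zero}  f = refl
Σᶠ-neg {suc n} f = trans (cong (_+_ (- f fzero)) (Σᶠ-neg (f ∘ fsuc))) (sym (ℤP.neg-distrib-+ (f fzero) _))

Σᶠ-*ˡ : ∀ {n} c (f : Fin n → ℤ) → Σᶠ (λ i → c * f i) ≡ c * Σᶠ f
Σᶠ-*ˡ {zero}  c f = sym (ℤP.*-zeroʳ c)
Σᶠ-*ˡ {suc n} c f = trans (cong (_+_ (c * f fzero)) (Σᶠ-*ˡ c (f ∘ fsuc))) (sym (ℤP.*-distribˡ-+ c (f fzero) _))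

Σᶠ-δ : ∀ {n} (f : Fin n → ℤ) j → Σᶠ (λ i → f i * δ i j) ≡ f j
Σᶠ-δ f j = begin
  Σᶠ (λ i → f i * δ i j)  ≡⟨ Σᶠ-single _ j (λ i i≢j → trans (cong (f i *_) (δ-≢ i≢j)) (ℤP.*-zeroʳ (f i))) ⟩
  f j * δ j j             ≡⟨ cong (f j *_) (δ-refl j) ⟩
  f j * + 1               ≡⟨ ℤP.*-identityʳ (f j) ⟩
  f j                     ∎

comb-formula : ∀ d (a : Fin (suc d) → ℤ) j → comb d a j ≡ + suc d * a j - Σᶠ a
comb-formula d a j = begin
  Σᶠ (λ i → a i * (N * δ i j - + 1))                ≡⟨ Σᶠ-cong (λ i → expand (a i) N (δ i j)) ⟩
  Σᶠ (λ i → N * (a i * δ i j) + - a i)              ≡⟨ Σᶠ-+ (λ i → N * (a i * δ i j)) (λ i → - a i) ⟩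
  Σᶠ (λ i → N * (a i * δ i j)) + Σᶠ (λ i → - a i)   ≡⟨ cong₂ _+_ (Σᶠ-*ˡ N (λ i → a i * δ i j)) (Σᶠ-neg a) ⟩
  N * Σᶠ (λ i → a i * δ i j) - Σᶠ a                 ≡⟨ cong (λ s → N * s - Σᶠ a) (Σᶠ-δ a j) ⟩
  N * a j - Σᶠ a                                    ∎
  where
  N = + suc d
  expand : ∀ x N e → x * (N * e - + 1) ≡ N * (x * e) + - x
  expand = solve-∀

comb-cong : ∀ d {a b : Fin (suc d) → ℤ} → (∀ i → a i ≡ b i) → ∀ j → comb d a j ≡ comb d b j
comb-cong d a≗b j = Σᶠ-cong (λ i → cong (_* w d i j) (a≗b i))

comb-sub : ∀ d (a b : Fin (suc d) → ℤ) j → comb d a j - comb d b j ≡ comb d (λ i → a i - b i) j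
comb-sub d a b j = begin
  comb d a j - comb d b j              ≡⟨ cong₂ _-_ (comb-formula d a j) (comb-formula d b j) ⟩
  (N * a j - Σᶠ a) - (N * b j - Σᶠ b)  ≡⟨ regroup N (a j) (b j) (Σᶠ a) (Σᶠ b) ⟩
  N * (a j - b j) - (Σᶠ a + - Σᶠ b)    ≡⟨ cong (λ s → N * (a j - b j) - s) (sym Σ[a-b]) ⟩
  N * (a j - b j) - Σᶠ (λ i → a i - b i)  ≡⟨ sym (comb-formula d (λ i → a i - b i) j) ⟩
  comb d (λ i → a i - b i) j           ∎
  where
  N = + suc d
  regroup : ∀ N x y S T → (N * x - S) - (N * y - T) ≡ N * (x - y) - (S + - T)
  regroup = solve-∀
  Σ[a-b] : Σᶠ (λ i → a i - b i) ≡ Σᶠ a + - Σᶠ b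
  Σ[a-b] = trans (Σᶠ-+ a (λ i → - b i)) (cong (_+_ (Σᶠ a)) (Σᶠ-neg b))

comb-kernel : ∀ d (c : Fin (suc d) → ℤ) → (∀ j → comb d c j ≡ + 0) → ∀ i → c i ≡ c fzero
comb-kernel d c c↦0 i = ℤP.*-cancelˡ-≡ (+ suc d) (c i) (c fzero) (ℤP.i-j≡0⇒i≡j _ _ (begin
  N * c i - N * c fzero                    ≡⟨ regroup (N * c i) (N * c fzero) (Σᶠ c) ⟩
  (N * c i - Σᶠ c) - (N * c fzero - Σᶠ c)  ≡⟨ cong₂ _-_ (sym (comb-formula d c i)) (sym (comb-formula d c fzero)) ⟩
  comb d c i - comb d c fzero              ≡⟨ cong₂ _-_ (c↦0 i) (c↦0 fzero) ⟩
  + 0                                      ∎))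
  where
  N = + suc d
  regroup : ∀ x y S → x - y ≡ (x - S) - (y - S)
  regroup = solve-∀

ι : ∀ {n} → (Fin n → ℕ) → Fin n → ℤ
ι a j = + a j

module Congruence (d : ℕ) (k : Fin (suc d) → ℕ) where
  open Cyclic d

  moves : (Fin (suc d) → ℤ) → Fin (suc d) → ℤ
  moves B j = B j * + suc (k j) - B (prev j) * + k j

  vecMat-M : ∀ B j → vecMat d B (M d k) j ≡ moves B j
  vecMat-M B j = begin
    Σᶠ (λ i → B i * (+ suc (k i) * δ i j + - + k (nxt d i) * δ (nxt d i) j))
      ≡⟨ Σᶠ-cong (λ i → expand (B i) (+ suc (k i)) (δ i j) (+ k (nxt d i)) (δ (nxt d i) j)) ⟩
    Σᶠ (λ i → B i * + suc (k i) * δ i j + - (B i * + k (nxt d i) * δ (nxt d i) j))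
      ≡⟨ Σᶠ-+ (λ i → B i * + suc (k i) * δ i j) (λ i → - (B i * + k (nxt d i) * δ (nxt d i) j)) ⟩
    Σᶠ (λ i → B i * + suc (k i) * δ i j) + Σᶠ (λ i → - (B i * + k (nxt d i) * δ (nxt d i) j))
      ≡⟨ cong₂ _+_ (Σᶠ-δ (λ i → B i * + suc (k i)) j) (Σᶠ-neg (λ i → B i * + k (nxt d i) * δ (nxt d i) j)) ⟩
    B j * + suc (k j) - Σᶠ (λ i → B i * + k (nxt d i) * δ (nxt d i) j)
      ≡⟨ cong (λ s → B j * + suc (k j) - s) inflow ⟩
    moves B j ∎
    where
    expand : ∀ b K e L e′ → b * (K * e + - L * e′) ≡ b * K * e + - (b * L * e′)
    expand = solve-∀
    inflow : Σᶠ (λ i → B i * + k (nxt d i) * δ (nxt d i) j) ≡ B (prev j) * + k j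
    inflow = begin
      Σᶠ (λ i → B i * + k (nxt d i) * δ (nxt d i) j)
        ≡⟨ Σᶠ-single _ (prev j) (λ i i≢pj → trans (cong (B i * + k (nxt d i) *_) (δ-≢ (i≢pj ∘ nxt≡j⇒prev i)))
                                                   (ℤP.*-zeroʳ (B i * + k (nxt d i)))) ⟩
      B (prev j) * + k (nxt d (prev j)) * δ (nxt d (prev j)) j
        ≡⟨ cong (λ i → B (prev j) * + k i * δ i j) (nxt-prev j) ⟩
      B (prev j) * + k j * δ j j
        ≡⟨ trans (cong (B (prev j) * + k j *_) (δ-refl j)) (ℤP.*-identityʳ _) ⟩
      B (prev j) * + k j ∎
      where
      nxt≡j⇒prev : ∀ i → nxt d i ≡ j → i ≡ prev j
      nxt≡j⇒prev i refl = sym (prev-nxt i)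

  infix 4 _∼_
  record _∼_ (u v : Fin (suc d) → ℤ) : Set where
    constructor by-moves
    field
      firings    : Fin (suc d) → ℤ
      difference : ∀ j → u j - v j ≡ moves firings j

  moves-0 : ∀ j → moves (λ _ → + 0) j ≡ + 0
  moves-0 j = zeros (+ suc (k j)) (+ k j)
    where
    zeros : ∀ K L → + 0 * K - + 0 * L ≡ + 0
    zeros = solve-∀

  ∼-refl : ∀ {u} → u ∼ u
  ∼-refl {u} = by-moves (λ _ → + 0) λ j → trans (ℤP.+-inverseʳ (u j)) (sym (moves-0 j))

  ∼-trans : ∀ {u v w} → u ∼ v → v ∼ w → u ∼ w
  ∼-trans {u} {v} {w} (by-moves B u-v) (by-moves C v-w) = by-moves (λ i → B i + C i) λ j → begin
    u j - w j                    ≡⟨ telescope (u j) (v j) (w j) ⟩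
    (u j - v j) + (v j - w j)    ≡⟨ cong₂ _+_ (u-v j) (v-w j) ⟩
    moves B j + moves C j        ≡⟨ collect (B j) (C j) (+ suc (k j)) (B (prev j)) (C (prev j)) (+ k j) ⟩
    moves (λ i → B i + C i) j    ∎
    where
    telescope : ∀ u v w → u - w ≡ (u - v) + (v - w)
    telescope = solve-∀
    collect : ∀ b c K p q L → (b * K - p * L) + (c * K - q * L) ≡ (b + c) * K - (p + q) * L
    collect = solve-∀

  ∼-sym : ∀ {u v} → u ∼ v → v ∼ u
  ∼-sym {u} {v} (by-moves B u-v) = by-moves (λ i → - B i) λ j → begin
    v j - u j                  ≡⟨ swap (u j) (v j) ⟩
    - (u j - v j)              ≡⟨ cong -_ (u-v j) ⟩
    - moves B j                ≡⟨ negate (B j) (B (prev j)) (+ suc (k j)) (+ k j) ⟩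
    moves (λ i → - B i) j      ∎
    where
    swap : ∀ u v → v - u ≡ - (u - v)
    swap = solve-∀
    negate : ∀ b p K L → - (b * K - p * L) ≡ - b * K - - p * L
    negate = solve-∀

  -- t j is the number of firings of the site before j; B = t ∘ nxt counts the firings of j itself.
  balanced⇒∼ : ∀ u v (t : Fin (suc d) → ℤ) →
    (∀ j → u j + t j * + k j ≡ v j + t (nxt d j) * + suc (k j)) → u ∼ v
  balanced⇒∼ u v t balance = by-moves (t ∘ nxt d) λ j → begin
    u j - v j                                  ≡⟨ shift (u j) (v j) (t j * + k j) ⟩
    (u j + t j * + k j) - (v j + t j * + k j)  ≡⟨ cong (_- (v j + t j * + k j)) (balance j) ⟩
    (v j + t (nxt d j) * + suc (k j)) - (v j + t j * + k j)
      ≡⟨ cancel (v j) (t (nxt d j) * + suc (k j)) (t j * + k j) ⟩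
    t (nxt d j) * + suc (k j) - t j * + k j
      ≡⟨ cong (λ i → t (nxt d j) * + suc (k j) - t i * + k j) (sym (nxt-prev j)) ⟩
    moves (t ∘ nxt d) j                        ∎
    where
    shift : ∀ u v c → u - v ≡ (u + c) - (v + c)
    shift = solve-∀
    cancel : ∀ v x y → (v + x) - (v + y) ≡ x - y
    cancel = solve-∀

  balancedℕ⇒∼ : ∀ (a a′ t : Fin (suc d) → ℕ) →
    (∀ j → a j ℕ.+ t j ℕ.* k j ≡ a′ j ℕ.+ t (nxt d j) ℕ.* suc (k j)) → ι a ∼ ι a′
  balancedℕ⇒∼ a a′ t balance = balanced⇒∼ (ι a) (ι a′) (ι t) λ j → begin
    + a j + + t j * + k j                         ≡⟨ cast (a j) (t j) (k j) ⟨
    + (a j ℕ.+ t j ℕ.* k j)                       ≡⟨ cong +_ (balance j) ⟩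
    + (a′ j ℕ.+ t (nxt d j) ℕ.* suc (k j))        ≡⟨ cast (a′ j) (t (nxt d j)) (suc (k j)) ⟩
    + a′ j + + t (nxt d j) * + suc (k j)          ∎
    where
    cast : ∀ x y z → + (x ℕ.+ y ℕ.* z) ≡ + x + + y * + z
    cast x y z = trans (ℤP.pos-+ x (y ℕ.* z)) (cong (_+_ (+ x)) (ℤP.pos-* y z))

  InL-cong : ∀ {x y} → (∀ j → x j ≡ y j) → InL d k x → InL d k y
  InL-cong x≗y (B , x∈L) = B , λ j → trans (sym (x≗y j)) (x∈L j)

  ∼⇒InL : ∀ {a b} → a ∼ b → InL d k (comb d a ⊖ comb d b)
  ∼⇒InL {a} {b} (by-moves B a-b) = B , λ j → begin
    comb d a j - comb d b j       ≡⟨ comb-sub d a b j ⟩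
    comb d (λ i → a i - b i) j    ≡⟨ comb-cong d (λ i → trans (a-b i) (sym (vecMat-M B i))) j ⟩
    comb d (vecMat d B (M d k)) j ∎

  InL⇒∼ : ∀ {a b} → InL d k (comb d a ⊖ comb d b) → a ∼ b
  InL⇒∼ {a} {b} (B , x≡comb) = by-moves (λ i → B i + t) λ j → begin
    a j - b j                  ≡⟨ split (a j - b j) (bM j) ⟩
    bM j + c j                 ≡⟨ cong₂ _+_ (vecMat-M B j) (comb-kernel d c c↦0 j) ⟩
    moves B j + t              ≡⟨ absorb (B j) (B (prev j)) t (+ k j) ⟩
    moves (λ i → B i + t) j    ∎
    where
    bM = vecMat d B (M d k)
    c : Fin (suc d) → ℤ
    c i = (a i - b i) - bM i
    t = c fzero
    c↦0 : ∀ j → comb d c j ≡ + 0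
    c↦0 j = begin
      comb d c j                                ≡⟨ comb-sub d (λ i → a i - b i) bM j ⟨
      comb d (λ i → a i - b i) j - comb d bM j  ≡⟨ cong (_- comb d bM j) (comb-sub d a b j) ⟨
      comb d a j - comb d b j - comb d bM j     ≡⟨ cong (_- comb d bM j) (x≡comb j) ⟩
      comb d bM j - comb d bM j                 ≡⟨ ℤP.+-inverseʳ (comb d bM j) ⟩
      + 0                                       ∎
    split : ∀ x y → x ≡ y + (x - y)
    split = solve-∀
    absorb : ∀ b p t K → (b * (+ 1 + K) - p * K) + t ≡ (b + t) * (+ 1 + K) - (p + t) * K
    absorb = solve-∀

quotient≤1 : ∀ x K → x ≤ K ℕ.+ K → x / suc K ≤ 1
quotient≤1 x K x≤2K = ℕP.m<1+n⇒m≤n (m<n*o⇒m/o<n {x} {2} {suc K}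
  (s≤s (ℕP.≤-trans x≤2K (ℕP.+-monoʳ-≤ K (ℕP.≤-trans (ℕP.n≤1+n K)
                                                     (ℕP.≤-reflexive (sym (ℕP.+-identityʳ (suc K)))))))))

-- carry m is the number of firings of site m - 1 (of the last site when m = 0): each site before the last fires
-- as often as its load allows, the last one exactly ε times, which needs ε (k + 1) chips there.
module Sweep (d : ℕ) (k : Fin (suc d) → ℕ) (ε : ℕ) (a : Fin (suc d) → ℕ) where
  open Cyclic d

  carry : ℕ → ℕ
  carry zero    = ε
  carry (suc m) = (a (pos m) ℕ.+ carry m ℕ.* k (pos m)) / suc (k (pos m))

  incoming : Fin (suc d) → ℕ
  incoming j = carry (toℕ j)

  load : Fin (suc d) → ℕ
  load j = a j ℕ.+ incoming j ℕ.* k j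

  sweep : Fin (suc d) → ℕ
  sweep j = load j ∸ incoming (nxt d j) ℕ.* suc (k j)

  outgoing-below : ∀ {j} → toℕ j < d → incoming (nxt d j) ≡ load j / suc (k j)
  outgoing-below {j} j<d = begin
    carry (toℕ (nxt d j))  ≡⟨ cong carry (toℕ-nxt j<d) ⟩
    carry (suc (toℕ j))    ≡⟨ cong (λ i → (a i ℕ.+ carry (toℕ j) ℕ.* k i) / suc (k i)) (pos-toℕ j) ⟩
    load j / suc (k j)     ∎

  outgoing-last : incoming (nxt d (fromℕ d)) ≡ ε
  outgoing-last = cong incoming nxt-last

  sweep-balanced : ε ℕ.* suc (k (fromℕ d)) ≤ a (fromℕ d) →
    ∀ j → a j ℕ.+ incoming j ℕ.* k j ≡ sweep j ℕ.+ incoming (nxt d j) ℕ.* suc (k j)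
  sweep-balanced ε≤last j = sym (ℕP.m∸n+n≡m (outflow≤load j))
    where
    outflow≤load : ∀ j → incoming (nxt d j) ℕ.* suc (k j) ≤ load j
    outflow≤load j with below-or-last j
    ... | inj₁ j<d  = subst (λ q → q ℕ.* suc (k j) ≤ load j) (sym (outgoing-below j<d)) (m/n*n≤m (load j) (suc (k j)))
    ... | inj₂ refl = subst (λ q → q ℕ.* suc (k j) ≤ load j) (sym outgoing-last) (ℕP.≤-trans ε≤last (ℕP.m≤m+n _ _))

  sweep-below : ∀ {j} → toℕ j < d → sweep j ≤ k j
  sweep-below {j} j<d = ℕP.m<1+n⇒m≤n (subst (_< suc (k j)) (sym sweep≡mod) (m%n<n (load j) (suc (k j))))
    where
    sweep≡mod : sweep j ≡ load j % suc (k j)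
    sweep≡mod = begin
      sweep j                                    ≡⟨ cong (λ q → load j ∸ q ℕ.* suc (k j)) (outgoing-below j<d) ⟩
      load j ∸ load j / suc (k j) ℕ.* suc (k j)  ≡⟨ m%n≡m∸m/n*n (load j) (suc (k j)) ⟨
      load j % suc (k j)                         ∎

  carry≤1 : ε ≤ 1 → (∀ j → toℕ j < d → a j ≤ k j) → ∀ m → m ≤ d → carry m ≤ 1
  carry≤1 ε≤1 below zero    _   = ε≤1
  carry≤1 ε≤1 below (suc m) m<d = quotient≤1 _ _ (ℕP.+-mono-≤ a≤k inflow≤k)
    where
    i = pos m
    a≤k : a i ≤ k i
    a≤k = below i (subst (_< d) (sym (toℕ-pos (ℕP.m≤n⇒m≤1+n m<d))) m<d)
    inflow≤k : carry m ℕ.* k i ≤ k i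
    inflow≤k = ℕP.≤-trans (ℕP.*-monoˡ-≤ (k i) (carry≤1 ε≤1 below m (ℕP.<⇒≤ m<d)))
                          (ℕP.≤-reflexive (ℕP.*-identityˡ (k i)))

m+n∸1+n<m : ∀ {m} n → 0 < m → (m ℕ.+ n) ∸ suc n < m
m+n∸1+n<m {suc m} n _ = s≤s (ℕP.≤-reflexive (ℕP.m+n∸n≡m m n))

argmin : ∀ {n} (f : Fin (suc n) → ℕ) → ∃ λ i → ∀ j → f i ≤ f j
argmin {zero}  f = fzero , λ { fzero → ℕP.≤-refl }
argmin {suc n} f with argmin (f ∘ fsuc)
... | i , min with f fzero ℕP.≤? f (fsuc i)
...   | yes f₀≤ = fzero , λ { fzero → ℕP.≤-refl ; (fsuc j) → ℕP.≤-trans f₀≤ (min j) }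
...   | no f₀≰  = fsuc i , λ { fzero → ℕP.<⇒≤ (ℕP.≰⇒> f₀≰) ; (fsuc j) → min j }

sumℕ : ∀ {n} → (Fin n → ℕ) → ℕ
sumℕ {zero}  f = 0
sumℕ {suc n} f = f fzero ℕ.+ sumℕ (f ∘ fsuc)

≤-sumℕ : ∀ {n} (f : Fin n → ℕ) i → f i ≤ sumℕ f
≤-sumℕ f fzero    = ℕP.m≤m+n _ _
≤-sumℕ f (fsuc i) = ℕP.≤-trans (≤-sumℕ (f ∘ fsuc) i) (ℕP.m≤n+m _ (f fzero))

+∣i+n∣≡i+n : ∀ i n → ℤ.∣ i ∣ ≤ n → + ℤ.∣ i + + n ∣ ≡ i + + n
+∣i+n∣≡i+n (+ m)      n _     = refl
+∣i+n∣≡i+n ℤ.-[1+ m ] n m<n = trans (cong (λ i → + ℤ.∣ i ∣) (ℤP.⊖-≥ m<n)) (sym (ℤP.⊖-≥ m<n))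

module Reduction (d : ℕ) (k : Fin (suc d) → ℕ) where
  open Cyclic d
  open Congruence d k

  Boxed : (Fin (suc d) → ℕ) → Set
  Boxed a = ∀ j → a j ≤ k j

  BoxedBelowLast : (Fin (suc d) → ℕ) → Set
  BoxedBelowLast a = ∀ j → toℕ j < d → a j ≤ k j

  Reduced : (Fin (suc d) → ℕ) → Set
  Reduced f = Boxed f × ∃ λ i → f i ≡ 0

  Representative : ((Fin (suc d) → ℕ) → Set) → (Fin (suc d) → ℤ) → Set
  Representative P u = Σ (Fin (suc d) → ℕ) λ a → P a × u ∼ ι a

  ∼-representative : ∀ {P u v} → u ∼ v → Representative P v → Representative P u
  ∼-representative u∼v (a , Pa , v∼a) = a , Pa , ∼-trans u∼v v∼a

  boxed : ∀ {a} → BoxedBelowLast a → a (fromℕ d) ≤ k (fromℕ d) → Boxed a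
  boxed below last≤k j with below-or-last j
  ... | inj₁ j<d  = below j j<d
  ... | inj₂ refl = last≤k

  module _ (ε : ℕ) (a : Fin (suc d) → ℕ) where
    open Sweep d k ε a

    sweep-∼ : ε ℕ.* suc (k (fromℕ d)) ≤ a (fromℕ d) → ι a ∼ ι sweep
    sweep-∼ ε≤last = balancedℕ⇒∼ a sweep incoming (sweep-balanced ε≤last)

    sweep-boxedBelowLast : BoxedBelowLast sweep
    sweep-boxedBelowLast j = sweep-below

  -- Every carry is at most 1, so the last site gains at most k and loses k + 1 chips.
  sweep₁-last-< : ∀ a → BoxedBelowLast a → k (fromℕ d) < a (fromℕ d) →
    Sweep.sweep d k 1 a (fromℕ d) < a (fromℕ d)
  sweep₁-last-< a below k<last = ℕP.≤-<-trans sweep≤ (m+n∸1+n<m (k L) (ℕP.≤-<-trans z≤n k<last))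
    where
    open Sweep d k 1 a
    L = fromℕ d
    incoming≤1 : incoming L ≤ 1
    incoming≤1 = carry≤1 (s≤s z≤n) below (toℕ L) (ℕP.≤-reflexive (FinP.toℕ-fromℕ d))
    load≤ : load L ≤ a L ℕ.+ k L
    load≤ = ℕP.+-monoʳ-≤ (a L) (ℕP.≤-trans (ℕP.*-monoˡ-≤ (k L) incoming≤1)
                                           (ℕP.≤-reflexive (ℕP.*-identityˡ (k L))))
    sweep≤ : sweep L ≤ (a L ℕ.+ k L) ∸ suc (k L)
    sweep≤ = ℕP.≤-trans (ℕP.≤-reflexive (cong (λ q → load L ∸ q ℕ.* suc (k L)) outgoing-last))
                        (ℕP.∸-mono load≤ (ℕP.≤-reflexive (sym (ℕP.*-identityˡ (suc (k L))))))

  reduce-last : ∀ n a → a (fromℕ d) ≤ n → BoxedBelowLast a → Representative Boxed (ι a)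
  reduce-last zero    a last≤0 below = a , boxed below (ℕP.≤-trans last≤0 z≤n) , ∼-refl
  reduce-last (suc n) a last≤n below with a (fromℕ d) ℕP.≤? k (fromℕ d)
  ... | yes last≤k = a , boxed below last≤k , ∼-refl
  ... | no last≰k  = ∼-representative (sweep-∼ 1 a one-firing)
                       (reduce-last n (Sweep.sweep d k 1 a) sweep-last≤n (sweep-boxedBelowLast 1 a))
    where
    k<last = ℕP.≰⇒> last≰k
    one-firing : 1 ℕ.* suc (k (fromℕ d)) ≤ a (fromℕ d)
    one-firing = subst (_≤ a (fromℕ d)) (sym (ℕP.*-identityˡ _)) k<last
    sweep-last≤n : Sweep.sweep d k 1 a (fromℕ d) ≤ n
    sweep-last≤n = ℕP.m<1+n⇒m≤n (ℕP.<-≤-trans (sweep₁-last-< a below k<last) last≤n)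

  subtract-min : ∀ a → Boxed a → Representative Reduced (ι a)
  subtract-min a box with argmin a
  ... | i₀ , min = f , (f≤k , i₀ , ℕP.n∸n≡0 (a i₀)) , balancedℕ⇒∼ a f (λ _ → a i₀) balance
    where
    f : Fin (suc d) → ℕ
    f j = a j ∸ a i₀
    f≤k : Boxed f
    f≤k j = ℕP.≤-trans (ℕP.m∸n≤m (a j) (a i₀)) (box j)
    balance : ∀ j → a j ℕ.+ a i₀ ℕ.* k j ≡ f j ℕ.+ a i₀ ℕ.* suc (k j)
    balance j = begin
      a j ℕ.+ a i₀ ℕ.* k j              ≡⟨ cong (ℕ._+ a i₀ ℕ.* k j) (ℕP.m∸n+n≡m (min j)) ⟨
      f j ℕ.+ a i₀ ℕ.+ a i₀ ℕ.* k j     ≡⟨ ℕP.+-assoc (f j) (a i₀) _ ⟩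
      f j ℕ.+ (a i₀ ℕ.+ a i₀ ℕ.* k j)   ≡⟨ cong (f j ℕ.+_) (ℕP.*-suc (a i₀) (k j)) ⟨
      f j ℕ.+ a i₀ ℕ.* suc (k j)        ∎

  shift-to-ℕ : ∀ u → Σ (Fin (suc d) → ℕ) λ a → u ∼ ι a
  shift-to-ℕ u = a , balanced⇒∼ u (ι a) (λ _ → - + T) balance
    where
    T = sumℕ (λ j → ℤ.∣ u j ∣)
    a : Fin (suc d) → ℕ
    a j = ℤ.∣ u j + + T ∣
    shift : ∀ u t K → u + - t * K ≡ (u + t) + - t * (+ 1 + K)
    shift = solve-∀
    balance : ∀ j → u j + - + T * + k j ≡ + a j + - + T * + suc (k j)
    balance j = trans (shift (u j) (+ T) (+ k j))
      (cong (_+ - + T * + suc (k j)) (sym (+∣i+n∣≡i+n (u j) T (≤-sumℕ (λ j → ℤ.∣ u j ∣) j))))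

  boxed⇒reduced : ∀ {u} → Representative Boxed u → Representative Reduced u
  boxed⇒reduced (a , box , u∼a) = ∼-representative u∼a (subtract-min a box)

  normal-form : ∀ u → Representative Reduced u
  normal-form u with shift-to-ℕ u
  ... | a₀ , u∼a₀ = ∼-representative (∼-trans u∼a₀ (sweep-∼ 0 a₀ z≤n))
                      (boxed⇒reduced (reduce-last _ a₁ ℕP.≤-refl (sweep-boxedBelowLast 0 a₀)))
    where a₁ = Sweep.sweep d k 0 a₀

≤0⊎≥1 : ∀ i → i ≤ℤ + 0 ⊎ + 1 ≤ℤ i
≤0⊎≥1 (+ zero)     = inj₁ (+≤+ z≤n)
≤0⊎≥1 (+ suc n)    = inj₂ (+≤+ (s≤s z≤n))
≤0⊎≥1 ℤ.-[1+ n ]   = inj₁ ℤ.-≤+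

-- If p < b then b (K + 1) - p K = (b + K) + (b - p - 1) K ≥ 1 + K.
descent : ∀ b p K → + 1 ≤ℤ b → b * + suc K - p * + K ≤ℤ + K → b ≤ℤ p
descent b p K 1≤b bound with b ℤP.≤? p
... | yes b≤p = b≤p
... | no  b≰p = ⊥-elim (ℕP.<-irrefl refl (ℤP.drop‿+≤+ (ℤP.≤-trans 1+K≤ bound)))
  where
  gap≥0 : + 0 ≤ℤ (b - (+ 1 + p)) * + K
  gap≥0 = ℤP.*-monoʳ-≤-nonNeg (+ K) (ℤP.i≤j⇒0≤j-i (ℤP.i<j⇒suc[i]≤j (ℤP.≰⇒> b≰p)))
  regroup : ∀ b p K → b * (+ 1 + K) - p * K ≡ (b + K) + (b - (+ 1 + p)) * K
  regroup = solve-∀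
  1+K≤ : + 1 + + K ≤ℤ b * + suc K - p * + K
  1+K≤ = subst₂ _≤ℤ_ (ℤP.+-identityʳ (+ 1 + + K)) (sym (regroup b p (+ K)))
           (ℤP.+-mono-≤ (ℤP.+-monoˡ-≤ (+ K) 1≤b) gap≥0)

module Uniqueness (d : ℕ) (k : Fin (suc d) → ℕ) where
  open Cyclic d
  open Congruence d k
  open Reduction d k

  firings-nonpositive : ∀ {f f′ : Fin (suc d) → ℕ} → Reduced f →
    ∀ B → (∀ j → + f j - + f′ j ≡ moves B j) → ∀ j → B j ≤ℤ + 0
  firings-nonpositive {f} {f′} (box , i₁ , fi₁≡0) B diff j with ≤0⊎≥1 (B j)
  ... | inj₁ Bj≤0 = Bj≤0
  ... | inj₂ 1≤Bj = ⊥-elim (ℕP.<-irrefl refl (ℤP.drop‿+≤+ (ℤP.≤-trans 1≤moves moves≤0)))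
    where
    B≤B∘prev : ∀ j → + 1 ≤ℤ B j → B j ≤ℤ B (prev j)
    B≤B∘prev j 1≤Bj = descent (B j) (B (prev j)) (k j) 1≤Bj
      (subst (_≤ℤ + k j) (diff j) (ℤP.i≤j⇒i-k≤j (+ f′ j) (+≤+ (box j))))
    minimal : ∀ {j₀} → + 1 ≤ℤ B j₀ → ∀ i → B j₀ ≤ℤ B i
    minimal {j₀} 1≤Bj₀ = prev-induction (λ i → B j₀ ≤ℤ B i)
      (λ i Bj₀≤Bi → ℤP.≤-trans Bj₀≤Bi (B≤B∘prev i (ℤP.≤-trans 1≤Bj₀ Bj₀≤Bi))) ℤP.≤-refl
    positive : ∀ i → + 1 ≤ℤ B i
    positive i = ℤP.≤-trans 1≤Bj (minimal 1≤Bj i)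
    flat : B (prev i₁) ≡ B i₁
    flat = ℤP.≤-antisym (minimal (positive (prev i₁)) i₁) (B≤B∘prev i₁ (positive i₁))
    collapse : ∀ b K → b * (+ 1 + K) - b * K ≡ b
    collapse = solve-∀
    1≤moves : + 1 ≤ℤ moves B i₁
    1≤moves = subst (+ 1 ≤ℤ_) (sym (trans (cong (λ p → B i₁ * + suc (k i₁) - p * + k i₁) flat)
                                          (collapse (B i₁) (+ k i₁))))
                (positive i₁)
    moves≤0 : moves B i₁ ≤ℤ + 0
    moves≤0 = subst (_≤ℤ + 0) (diff i₁) (ℤP.i≤j⇒i-k≤j (+ f′ i₁) (+≤+ (ℕP.≤-reflexive fi₁≡0)))

  reduced-unique : ∀ {f f′} → Reduced f → Reduced f′ → ι f ∼ ι f′ → ∀ j → f j ≡ f′ j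
  reduced-unique {f} {f′} red red′ f∼f′@(by-moves B diff) j =
    ℤP.+-injective (ℤP.i-j≡0⇒i≡j (+ f j) (+ f′ j) (trans (diff j) moves≡0))
    where
    0≤B : ∀ i → + 0 ≤ℤ B i
    0≤B i = subst (+ 0 ≤ℤ_) (ℤP.neg-involutive (B i))
              (ℤP.neg-mono-≤ (firings-nonpositive {f′} {f} red′ (λ i → - B i)
                                                  (_∼_.difference (∼-sym f∼f′)) i))
    B≡0 : ∀ i → B i ≡ + 0
    B≡0 i = ℤP.≤-antisym (firings-nonpositive {f} {f′} red B diff i) (0≤B i)
    moves≡0 : moves B j ≡ + 0
    moves≡0 = trans (cong₂ (λ b p → b * + suc (k j) - p * + k j) (B≡0 j) (B≡0 (prev j))) (moves-0 j)

lemma4p12 : (d : ℕ) → 2 ≤ d → (k : Fin (suc d) → ℕ) → (∀ i → 0 < k i) →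
    IsSystemOfReps d k
lemma4p12 d _ k _ = existence , uniqueness
  where
  open Congruence d k
  open Reduction d k
  open Uniqueness d k

  existence : ∀ x → InΛ d x → Σ (Pt (suc d)) λ y → InF d k y × InL d k (x ⊖ y)
  existence x (u , x≡u) = represent (normal-form u)
    where
    represent : Representative Reduced u → Σ (Pt (suc d)) λ y → InF d k y × InL d k (x ⊖ y)
    represent (f , (box , has-zero) , u∼f) =
      comb d (ι f) , (f , box , has-zero , λ _ → refl) ,
      InL-cong (λ j → cong (_- comb d (ι f) j) (sym (x≡u j))) (∼⇒InL u∼f)

  uniqueness : ∀ y y′ → InF d k y → InF d k y′ → InL d k (y ⊖ y′) → ∀ j → y j ≡ y′ j
  uniqueness y y′ (f , box , has-zero , y≡f) (f′ , box′ , has-zero′ , y′≡f′) y-y′∈L j = begin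
    y j             ≡⟨ y≡f j ⟩
    comb d (ι f) j  ≡⟨ comb-cong d (cong +_ ∘ reduced-unique (box , has-zero) (box′ , has-zero′) f∼f′) j ⟩
    comb d (ι f′) j ≡⟨ y′≡f′ j ⟨
    y′ j            ∎
    where
    f∼f′ : ι f ∼ ι f′
    f∼f′ = InL⇒∼ (InL-cong (λ j → cong₂ _-_ (y≡f j) (y′≡f′ j)) y-y′∈L)
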